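{- Let $k \ge 2$ and $n \in \mathbb{N}$. Then every length-2 factor of $W_n^{(k)}$ belongs to $\mathcal{B}^{(k)}$, i.e. $\mathrm{Fac}_2(W_n^{(k)}) \subseteq \mathcal{B}^{(k)}$.
   Context: Words are over the alphabet $\mathbb{N}=\{0,1,2,\dots\}$; $(x.y)$ denotes the length-2 word with letters $x,y$; $\mathrm{Fac}_2(V)$ is the set of length-2 factors of $V$. For $n\in\mathbb{N}$ and a word $W=w_0\cdots w_{m-1}$, $n\oplus W=(w_0+n)\cdots(w_{m-1}+n)$. For $k\ge 2$, $\phi_k$ is the morphism of $\mathbb{N}^*$ defined for $i\in\mathbb{N}$, $0\le j\le k-1$ by $\phi_k(ki+j)=(ki)(ki+j+1)$ if $0\le j\le k-2$ and $\phi_k(ki+k-1)=ki+k$; $W_n^{(k)}=\phi_k^n(0)$. Define $\mathcal{B}_1^{(k)}=\{(ki)\oplus(a.k): i\in\mathbb{N}, a\ge1\}$, $\mathcal{B}_2^{(k)}=\{(ki)\oplus(0.b): i\in\mathbb{N}, 1\le b\le k-1\}$, $\mathcal{B}_3^{(k)}=\{(a.0): a\ge1\}$, $\mathcal{B}^{(k)}=\mathcal{B}_1^{(k)}\cup\mathcal{B}_2^{(k)}\cup\mathcal{B}_3^{(k)}$. -}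

module Defs where

open import Data.Nat using (ℕ; zero; suc; _+_; _*_; _<_; _≤_; _<?_; NonZero)
open import Data.Nat.DivMod using (_/_; _%_)
open import Data.List using (List; []; _∷_; _++_; concatMap)
open import Data.Product using (Σ; ∃; _×_; _,_)
open import Data.Sum using (_⊎_)
open import Relation.Binary.PropositionalEquality using (_≡_)
open import Relation.Nullary.Decidable using (does)
open import Data.Bool using (if_then_else_)

Word : Set
Word = List ℕ

_⊕_ : ℕ → Word → Word
n ⊕ [] = []
n ⊕ (w ∷ ws) = (w + n) ∷ (n ⊕ ws)

-- Writing m = k*i + j with 0 ≤ j ≤ k-1 (i = m / k, j = m % k):
--   φ_k(m) = (k i)(k i + j + 1)   if j ≤ k-2  (i.e. j+1 < k)
--   φ_k(m) = k i + k              if j = k-1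
φ-letter : (k : ℕ) → .{{_ : NonZero k}} → ℕ → Word
φ-letter k m =
  if does (suc (m % k) <? k)
  then (k * (m / k)) ∷ (k * (m / k) + suc (m % k)) ∷ []
  else (k * (m / k) + k) ∷ []

φ : (k : ℕ) → .{{_ : NonZero k}} → Word → Word
φ k = concatMap (φ-letter k)

φ^ : (k : ℕ) → .{{_ : NonZero k}} → ℕ → Word → Word
φ^ k zero w = w
φ^ k (suc n) w = φ k (φ^ k n w)

W : (k : ℕ) → .{{_ : NonZero k}} → ℕ → Word
W k n = φ^ k n (0 ∷ [])

IsFac₂ : ℕ → ℕ → Word → Set
IsFac₂ x y V = Σ Word λ u → Σ Word λ v → u ++ (x ∷ y ∷ v) ≡ V

B₁ : ℕ → ℕ → ℕ → Set
B₁ k x y = Σ ℕ λ i → Σ ℕ λ a → 1 ≤ a × x ≡ a + k * i × y ≡ k + k * i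

B₂ : ℕ → ℕ → ℕ → Set
B₂ k x y = Σ ℕ λ i → Σ ℕ λ b → 1 ≤ b × b < k × x ≡ 0 + k * i × y ≡ b + k * i

B₃ : ℕ → ℕ → Set
B₃ x y = Σ ℕ λ a → 1 ≤ a × x ≡ a × y ≡ 0

B : ℕ → ℕ → ℕ → Set
B k x y = B₁ k x y ⊎ B₂ k x y ⊎ B₃ x y

{-# OPTIONS --safe #-}
-- The image φ_k(m) always ends with the letter m + 1, and begins with k⌊m/k⌋ unless it is
-- the single letter m + 1.  So a length-2 factor of φ_k(V) either lies inside one image,
-- where it is (ki, ki + j + 1) ∈ B₂, or straddles two consecutive images φ_k(x) φ_k(y),
-- where it is (x + 1, first letter of φ_k(y)) for a factor (x, y) of V.  B is closed under
-- (x, y) ↦ (x + 1, first letter of φ_k(y)), and the claim follows by induction on n.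
module Submission where

open import Defs
open import Data.Nat using (ℕ; zero; suc; _+_; _*_; _<_; _<?_; s≤s; z≤n; NonZero)
open import Data.Nat.Properties using (*-comm; *-suc; *-zeroʳ; +-comm; m≤n⇒m<n∨m≡n; <⇒≤; n<1+n; n≮n)
open import Data.Nat.DivMod
open import Data.Nat.Divisibility using (m∣m*n)
open import Data.List using (List; []; _∷_; _++_; head; last; concatMap)
open import Data.List.Properties using (++-identityʳ)
open import Data.List.Relation.Unary.Linked as Linked using (Linked; []; [-]; _∷_)
open import Data.List.Relation.Unary.Linked.Properties using (++⁺)
open import Data.Maybe.Relation.Binary.Connected using (Connected; just)
open import Data.Maybe using (just)
open import Data.Sum using (inj₁; inj₂; [_,_]′)
open import Data.Product using (_,_)
open import Data.Empty using (⊥-elim)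
open import Level using (Level)
open import Relation.Binary.Core using (Rel)
open import Relation.Binary.PropositionalEquality
open import Relation.Nullary.Decidable using (does; dec-true; dec-false)
open import Data.Bool using (if_then_else_)

private
  variable
    a ℓ : Level
    A : Set a

head-++ : ∀ {xs : List A} ys → xs ≢ [] → head (xs ++ ys) ≡ head xs
head-++ {xs = []}    ys xs≢[] = ⊥-elim (xs≢[] refl)
head-++ {xs = _ ∷ _} ys xs≢[] = refl

module _ {R : Rel A ℓ} (f : A → List A)
         (f-nonempty : ∀ x → f x ≢ [])
         (f-linked : ∀ x → Linked R (f x))
         (f-connected : ∀ {x y} → R x y → Connected R (last (f x)) (head (f y)))
         where

  concatMap⁺ : ∀ {xs} → Linked R xs → Linked R (concatMap f xs)
  concatMap⁺ []                 = []
  concatMap⁺ {xs = x ∷ []} [-]  = subst (Linked R) (sym (++-identityʳ (f x))) (f-linked x)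
  concatMap⁺ {xs = x ∷ y ∷ xs} (Rxy ∷ Rys) =
    ++⁺ (f-linked x)
        (subst (Connected R (last (f x))) (sym (head-++ (concatMap f xs) (f-nonempty y))) (f-connected Rxy))
        (concatMap⁺ Rys)

Linked-IsFac₂ : ∀ {R : Rel ℕ ℓ} {x y V} → IsFac₂ x y V → Linked R V → R x y
Linked-IsFac₂ ([]    , v , refl) RV = Linked.head RV
Linked-IsFac₂ (_ ∷ u , v , refl) RV = Linked-IsFac₂ (u , v , refl) (Linked.tail RV)

data DigitView (k : ℕ) : ℕ → Set where
  inner : ∀ i {j} → suc j < k → DigitView k (j + k * i)
  final : ∀ i {j} → suc j ≡ k → DigitView k (j + k * i)

module _ (k : ℕ) .{{_ : NonZero k}} where

  [j+k*i]%k≡j : ∀ i {j} → j < k → (j + k * i) % k ≡ j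
  [j+k*i]%k≡j i {j} j<k = trans (%-remove-+ʳ j (m∣m*n i)) (m<n⇒m%n≡m j<k)

  [j+k*i]/k≡i : ∀ i {j} → j < k → (j + k * i) / k ≡ i
  [j+k*i]/k≡i i {j} j<k = begin
    (j + k * i) / k    ≡⟨ +-distrib-/-∣ʳ j (m∣m*n i) ⟩
    j / k + k * i / k  ≡⟨ cong₂ _+_ (m<n⇒m/n≡0 j<k) (trans (/-congˡ (*-comm k i)) (m*n/n≡m i k)) ⟩
    i                  ∎
    where open ≡-Reasoning

  φ-letter-digits : ∀ i {j} → j < k →
    φ-letter k (j + k * i) ≡
      (if does (suc j <? k) then k * i ∷ k * i + suc j ∷ [] else k * i + k ∷ [])
  φ-letter-digits i j<k rewrite [j+k*i]%k≡j i j<k | [j+k*i]/k≡i i j<k = refl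

  φ-letter-inner : ∀ i {j} → suc j < k → φ-letter k (j + k * i) ≡ k * i ∷ suc j + k * i ∷ []
  φ-letter-inner i {j} 1+j<k
    rewrite φ-letter-digits i (<⇒≤ 1+j<k) | dec-true (suc j <? k) 1+j<k | +-comm (k * i) (suc j) = refl

  φ-letter-final : ∀ i {j} → suc j ≡ k → φ-letter k (j + k * i) ≡ k + k * i ∷ []
  φ-letter-final i {j} refl
    rewrite φ-letter-digits i (n<1+n j) | dec-false (suc j <? k) (n≮n k) | +-comm (k * i) k = refl

  digitView : ∀ m → DigitView k m
  digitView m =
    subst (DigitView k) (sym m≡m%k+k*[m/k])
          ([ inner (m / k) , final (m / k) ]′ (m≤n⇒m<n∨m≡n (m%n<n m k)))
    where
      m≡m%k+k*[m/k] : m ≡ m % k + k * (m / k)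
      m≡m%k+k*[m/k] = trans (m≡m%n+[m/n]*n m k) (cong (m % k +_) (*-comm (m / k) k))

  φ-letter-nonempty : ∀ m → φ-letter k m ≢ []
  φ-letter-nonempty m with digitView m
  ... | inner i 1+j<k rewrite φ-letter-inner i 1+j<k = λ ()
  ... | final i 1+j≡k rewrite φ-letter-final i 1+j≡k = λ ()

  last-φ-letter : ∀ m → last (φ-letter k m) ≡ just (suc m)
  last-φ-letter m with digitView m
  ... | inner i 1+j<k rewrite φ-letter-inner i 1+j<k = refl
  ... | final i refl  rewrite φ-letter-final i refl = refl

  φ-letter-Linked-B : ∀ m → Linked (B k) (φ-letter k m)
  φ-letter-Linked-B m with digitView m
  ... | inner i {j} 1+j<k rewrite φ-letter-inner i 1+j<k =
    inj₂ (inj₁ (i , suc j , s≤s z≤n , 1+j<k , refl , refl)) ∷ [-]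
  ... | final i 1+j≡k rewrite φ-letter-final i 1+j≡k = [-]

  φ-letter-zero : 1 < k → φ-letter k 0 ≡ 0 ∷ 1 ∷ []
  φ-letter-zero 1<k = subst (λ n → φ-letter k n ≡ n ∷ suc n ∷ []) (*-zeroʳ k) (φ-letter-inner 0 1<k)

  B-φ-boundary : 1 < k → ∀ {x y} → B k x y → Connected (B k) (just (suc x)) (head (φ-letter k y))
  -- y = k + k i has last digit 0, which is an inner digit only because k ≥ 2.
  B-φ-boundary 1<k (inj₁ (i , a , _ , refl , refl))
    rewrite sym (*-suc k i) | φ-letter-inner (suc i) 1<k = just (inj₁ (i , suc a , s≤s z≤n , refl , *-suc k i))
  B-φ-boundary 1<k (inj₂ (inj₁ (i , b , _ , b<k , refl , refl))) with m≤n⇒m<n∨m≡n b<k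
  ... | inj₁ 1+b<k rewrite φ-letter-inner i 1+b<k = just (suc-k*i i)
    where
      suc-k*i : ∀ i → B k (suc (k * i)) (k * i)
      suc-k*i zero    rewrite *-zeroʳ k = inj₂ (inj₂ (1 , s≤s z≤n , refl , refl))
      suc-k*i (suc i) rewrite *-suc k i = inj₁ (i , suc k , s≤s z≤n , refl , refl)
  ... | inj₂ 1+b≡k rewrite φ-letter-final i 1+b≡k = just (inj₁ (i , 1 , s≤s z≤n , refl , refl))
  B-φ-boundary 1<k (inj₂ (inj₂ (a , _ , refl , refl)))
    rewrite φ-letter-zero 1<k = just (inj₂ (inj₂ (suc a , s≤s z≤n , refl , refl)))

  W-Linked-B : 1 < k → ∀ n → Linked (B k) (W k n)
  W-Linked-B 1<k zero    = [-]
  W-Linked-B 1<k (suc n) =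
    concatMap⁺ (φ-letter k) φ-letter-nonempty φ-letter-Linked-B φ-connected (W-Linked-B 1<k n)
    where
      φ-connected : ∀ {x y} → B k x y → Connected (B k) (last (φ-letter k x)) (head (φ-letter k y))
      φ-connected {x} Bxy rewrite last-φ-letter x = B-φ-boundary 1<k Bxy

lemma5p3 : (k′ n x y : ℕ) → IsFac₂ x y (W (suc (suc k′)) n) → B (suc (suc k′)) x y
lemma5p3 k′ n x y xy∈W = Linked-IsFac₂ xy∈W (W-Linked-B (suc (suc k′)) (s≤s (s≤s z≤n)) n)
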